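{- There is an absolute constant $c>0$ such that the following holds. Let $D$ be a connected polytree on $n\ge 2$ nodes in which every node has at most $k$ parents. Then there exists a permutation $\sigma$ of the nodes of $D$ such that for all $i\in\{1,\dots,n\}$, $|S_i|-|T_i|\le c\cdot k\log n$, where $T_i=\{\sigma(1),\dots,\sigma(i)\}$ and $S_i=T_i\cup D_{\sigma(1)}\cup\dots\cup D_{\sigma(i)}$.
   Context: A DAG is a polytree if its skeleton (underlying undirected graph) is a forest; it is a connected polytree if its skeleton is a tree. For a node $v$, $D_v$ denotes the set of parents of $v$ in $D$. -}

module Defs where

open import Data.Nat using (ℕ; _+_; _*_; _≤_; _<_)
open import Data.Nat.Logarithm using (⌈log₂_⌉)
open import Data.Fin using (Fin)
open import Data.Fin.Subset using (Subset; _∈_; _∪_; ⋃; ⁅_⁆; ∣_∣)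
open import Data.Fin.Permutation using (Permutation′; _⟨$⟩ʳ_)
open import Data.List using (List; []; _∷_; _++_; [_]; map; take; allFin; length)
open import Data.List.Relation.Unary.Linked using (Linked)
open import Data.List.Relation.Unary.Unique.Propositional using (Unique)
open import Data.Sum using (_⊎_)
open import Data.Product using (_×_)
open import Data.Empty using (⊥)
open import Relation.Nullary using (¬_)
open import Relation.Binary.Construct.Closure.ReflexiveTransitive using (Star)

-- A directed graph on the nodes Fin n, given by its parent sets:
-- u is a parent of v (edge u → v) iff u ∈ D v.  So D v is D_v of the paper.
Digraph : ℕ → Set
Digraph n = Fin n → Subset n

module _ {n : ℕ} (D : Digraph n) where

  data Path : Fin n → Fin n → Set where
    edge : ∀ {u v} → u ∈ D v → Path u v
    step : ∀ {u v w} → u ∈ D v → Path v w → Path u w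

  IsDAG : Set
  IsDAG = ∀ v → ¬ Path v v

  Adj : Fin n → Fin n → Set
  Adj u v = (u ∈ D v) ⊎ (v ∈ D u)

  SkeletonConnected : Set
  SkeletonConnected = ∀ u v → Star Adj u v

  SkeletonCycle : Set
  SkeletonCycle = Data.Product.Σ (Fin n) λ x → Data.Product.Σ (List (Fin n)) λ xs →
    Unique (x ∷ xs) × (2 ≤ length xs) × Linked Adj ((x ∷ xs) ++ [ x ])

  SkeletonForest : Set
  SkeletonForest = ¬ SkeletonCycle

  IsConnectedPolytree : Set
  IsConnectedPolytree = IsDAG × SkeletonConnected × SkeletonForest

  MaxInDegree≤ : ℕ → Set
  MaxInDegree≤ k = ∀ v → ∣ D v ∣ ≤ k

  -- For a permutation σ (0-indexed: σ(1..i) of the paper = σ 0 .. σ (i-1))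
  firsts : Permutation′ n → ℕ → List (Fin n)
  firsts σ i = map (σ ⟨$⟩ʳ_) (take i (allFin n))

  T : Permutation′ n → ℕ → Subset n
  T σ i = ⋃ (map ⁅_⁆ (firsts σ i))

  S : Permutation′ n → ℕ → Subset n
  S σ i = T σ i ∪ ⋃ (map D (firsts σ i))

module Submission where

-- Root the skeleton of D (a tree) anywhere and list its vertices in postorder, always
-- descending into the largest subtree of a vertex first.  A prefix P of this order contains
-- the tree-children of its vertices, and in a polytree a parent of a vertex is a skeleton
-- neighbour, i.e. a tree-child or the tree-parent.  So S_i ∖ T_i consists of tree-parents
-- outside P of vertices in P.  These lie on a single root path, and each of them has its
-- heaviest subtree inside P, so below it the path continues into a subtree of at most half
-- its size; hence there are at most log₂ n of them, whatever k is.

open import Defs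
open import Data.Empty using (⊥-elim)
open import Data.Unit using (⊤; tt)
open import Data.Product using (Σ; ∃; _×_; _,_; proj₁; proj₂)
open import Data.Sum using (_⊎_; inj₁; inj₂; [_,_]′)
import Data.Sum as Sum
open import Data.Maybe using (just)
open import Function using (_∘_)
open import Relation.Nullary using (¬_; Dec; yes; no)
open import Relation.Nullary.Decidable using (_×-dec_; _⊎-dec_; ¬?)
open import Relation.Binary.PropositionalEquality hiding ([_])
open import Relation.Binary.Construct.Closure.ReflexiveTransitive using (Star; ε; _◅_)
open import Level using (0ℓ)
open import Relation.Binary.Bundles using (DecTotalOrder)
import Relation.Binary.Construct.On as On
import Relation.Binary.Construct.Flip.Ord as Flip

open import Data.Nat using (ℕ; zero; suc; _+_; _*_; _≤_; _<_; _^_; z≤n; s≤s)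
open import Data.Nat.Properties hiding (_≟_)
open import Data.Nat.Logarithm using (⌈log₂_⌉; ⌈log₂⌉-mono-≤; ⌈log₂2^n⌉≡n)
open import Data.Fin using (Fin; cast; _≟_)
open import Data.Fin.Properties using (injective⇒≤; cast-is-id)
open import Data.Fin.Subset using (Subset; ⋃; ⁅_⁆; ∣_∣; _∪_; inside; outside)
  renaming (_∈_ to _∈ₛ_; _⊆_ to _⊆ₛ_)
open import Data.Fin.Subset.Properties
  using (_∈?_; x∈p∪q⁻; x∈p∪q⁺; ∉⊥; ∣⊥∣≡0; ∣⁅x⁆∣≡1; x∈⁅x⁆; x∈⁅y⁆⇒x≡y; p⊆q⇒∣p∣≤∣q∣)
open import Data.Fin.Permutation
  using (Permutation; Permutation′; permutation; _⟨$⟩ʳ_; _∘ₚ_; cast-id; ↔⇒≡)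
open import Data.Vec using ([]; _∷_)

open import Data.List
  using (List; []; _∷_; _++_; [_]; _∷ʳ_; map; take; length; lookup; allFin; tabulate; reverse; head; filter)
open import Data.List.Properties
  using (∷-injective; ++-assoc; ++-conicalʳ; ∷ʳ-++; length-++; reverse-++; take++drop≡id;
         map-cong; take-map; map-tabulate; tabulate-lookup)
open import Data.List.Membership.Propositional using (_∈_; _∉_)
open import Data.List.Membership.Propositional.Properties
  using (∈-++⁺ˡ; ∈-++⁺ʳ; ∈-++⁻; ∈-∃++; ∈-map⁺; ∈-map⁻; ∈-filter⁺; ∈-filter⁻; ∈-allFin; ∈-lookup)
open import Data.List.Relation.Unary.All using (All; []; _∷_)
import Data.List.Relation.Unary.All as All
open import Data.List.Relation.Unary.All.Properties using (All¬⇒¬Any; ¬Any⇒All¬; all-filter)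
import Data.List.Relation.Unary.All.Properties as Allₚ
open import Data.List.Relation.Unary.Any using (here; there; index)
open import Data.List.Relation.Unary.Any.Properties using (lookup-index; reverse⁺)
open import Data.List.Relation.Unary.AllPairs using (AllPairs; []; _∷_)
import Data.List.Relation.Unary.AllPairs.Properties as AllPairs
open import Data.List.Relation.Unary.Linked using (Linked; []; [-]; _∷_)
open import Data.List.Relation.Unary.Linked.Properties using (Linked⇒AllPairs)
open import Data.List.Relation.Unary.Unique.Propositional using (Unique)
open import Data.List.Relation.Unary.Unique.Propositional.Properties
  using (filter⁺; allFin⁺) renaming (++⁺ to Unique-++⁺)
open import Data.List.Relation.Binary.Disjoint.Propositional using (Disjoint)
open import Data.List.Relation.Binary.Permutation.Propositional using (_↭_; ↭-sym; ↭⇒↭ₛ)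
open import Data.List.Relation.Binary.Permutation.Propositional.Properties using (∈-resp-↭)
import Data.List.Relation.Binary.Permutation.Setoid.Properties as Permutationₛ
import Data.List.Relation.Binary.Sublist.Propositional as Sublist
open Sublist using (_∷_; ⊆-refl; ⊆-trans; from∈; to∈) renaming (_⊆_ to _⊑_)
open import Data.List.Relation.Binary.Sublist.Propositional.Properties
  using (++⁺; ++⁺ˡ; ++⁺ʳ; ∷ˡ⁻; length-mono-≤)
import Data.List.Sort as Sort

private
  variable
    A : Set

prefix-of-++ : ∀ (P : List A) {B} X {Y} → P ++ B ≡ X ++ Y →
  (Σ (List A) λ B′ → B′ ≢ [] × P ++ B′ ≡ X) ⊎ (Σ (List A) λ P′ → P ≡ X ++ P′ × P′ ++ B ≡ Y)
prefix-of-++ P       []      e = inj₂ (P , refl , e)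
prefix-of-++ []      (x ∷ X) e = inj₁ (x ∷ X , (λ ()) , refl)
prefix-of-++ (p ∷ P) (x ∷ X) e with ∷-injective e
... | refl , e′ with prefix-of-++ P X e′
...   | inj₁ (B′ , B′≢[] , e″) = inj₁ (B′ , B′≢[] , cong (x ∷_) e″)
...   | inj₂ (P′ , e″ , e‴)    = inj₂ (P′ , cong (x ∷_) e″ , e‴)

proper-prefix-∷ʳ : ∀ (P : List A) {B} X {r} → P ++ B ≡ X ∷ʳ r → B ≢ [] → Σ (List A) λ B′ → P ++ B′ ≡ X
proper-prefix-∷ʳ []      X       e B≢[] = X , refl
proper-prefix-∷ʳ (p ∷ P) []      e B≢[] = ⊥-elim (B≢[] (++-conicalʳ P _ (proj₂ (∷-injective e))))
proper-prefix-∷ʳ (p ∷ P) (x ∷ X) e B≢[] with ∷-injective e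
... | refl , e′ with proper-prefix-∷ʳ P X e′ B≢[]
...   | B′ , e″ = B′ , cong (x ∷_) e″

Unique-++⁻ : ∀ (xs : List A) {ys} → Unique (xs ++ ys) → Unique xs × Unique ys × Disjoint xs ys
Unique-++⁻ []       u        = [] , u , λ ()
Unique-++⁻ (x ∷ xs) (x∉ ∷ u) with Unique-++⁻ xs u
... | uxs , uys , xs#ys = Allₚ.++⁻ˡ xs x∉ ∷ uxs , uys , λ
  { (here refl  , x∈ys) → All¬⇒¬Any (Allₚ.++⁻ʳ xs x∉) x∈ys
  ; (there v∈xs , v∈ys) → xs#ys (v∈xs , v∈ys) }

Unique-++⇒Disjoint : ∀ (xs : List A) {ys} → Unique (xs ++ ys) → Disjoint xs ys
Unique-++⇒Disjoint xs u = proj₂ (proj₂ (Unique-++⁻ xs u))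

last∉proper-prefix : ∀ (P : List A) {B} X {r} → Unique (X ∷ʳ r) → P ++ B ≡ X ∷ʳ r → B ≢ [] → r ∉ P
last∉proper-prefix P X u e B≢[] r∈P with proper-prefix-∷ʳ P X e B≢[]
... | B′ , refl = Unique-++⇒Disjoint (P ++ B′) u (∈-++⁺ˡ r∈P , here refl)

earlier-∈-prefix : ∀ (P : List A) {Q x y} → Unique (P ++ Q) → x ∷ y ∷ [] ⊑ P ++ Q → y ∈ P → x ∈ P
earlier-∈-prefix (p ∷ P) (p∉ ∷ _) (.p Sublist.∷ʳ x∷p⊑) (here refl)  = ⊥-elim (All¬⇒¬Any p∉ (to∈ (∷ˡ⁻ x∷p⊑)))
earlier-∈-prefix (p ∷ P) (_ ∷ u)  (.p Sublist.∷ʳ x∷y⊑) (there y∈P) = there (earlier-∈-prefix P u x∷y⊑ y∈P)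
earlier-∈-prefix (p ∷ P) _        (refl ∷ _)           _           = here refl

AllPairs-of-distinct : ∀ {P : A → Set} {R : A → A → Set} {xs} → (∀ {x y} → P x → P y → x ≢ y → R x y) →
  All P xs → Unique xs → AllPairs R xs
AllPairs-of-distinct r []         []       = []
AllPairs-of-distinct r (px ∷ pxs) (x∉ ∷ u) =
  All.zipWith (λ (py , x≢y) → r px py x≢y) (pxs , x∉) ∷ AllPairs-of-distinct r pxs u

lookup-injective : ∀ {xs : List A} → Unique xs → ∀ {i j} → lookup xs i ≡ lookup xs j → i ≡ j
lookup-injective {xs = _ ∷ _}  _        {Fin.zero}  {Fin.zero}  _ = refl
lookup-injective {xs = _ ∷ _}  (x∉ ∷ _) {Fin.zero}  {Fin.suc j} e = ⊥-elim (All.lookup x∉ (∈-lookup j) e)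
lookup-injective {xs = _ ∷ _}  (x∉ ∷ _) {Fin.suc i} {Fin.zero}  e = ⊥-elim (All.lookup x∉ (∈-lookup i) (sym e))
lookup-injective {xs = _ ∷ _}  (_ ∷ u)  {Fin.suc i} {Fin.suc j} e = cong Fin.suc (lookup-injective u e)

take-lookup-cast : ∀ {m} (xs : List A) (e : length xs ≡ m) i →
  map (lookup xs ∘ cast (sym e)) (take i (allFin m)) ≡ take i xs
take-lookup-cast xs refl i = begin
  map (lookup xs ∘ cast refl) (take i (allFin _))  ≡⟨ map-cong (cong (lookup xs) ∘ cast-is-id refl) _ ⟩
  map (lookup xs) (take i (allFin _))              ≡⟨ take-map i (allFin _) ⟨
  take i (map (lookup xs) (allFin _))              ≡⟨ cong (take i) (map-tabulate (λ j → j) (lookup xs)) ⟩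
  take i (tabulate (lookup xs))                    ≡⟨ cong (take i) (tabulate-lookup xs) ⟩
  take i xs                                        ∎
  where open ≡-Reasoning

Unique⇒length≤ : ∀ {n} {xs : List (Fin n)} → Unique xs → length xs ≤ n
Unique⇒length≤ u = injective⇒≤ (lookup-injective u)

enumeration↔ : ∀ {n} (xs : List (Fin n)) → Unique xs → (∀ x → x ∈ xs) → Permutation (length xs) n
enumeration↔ xs u complete = permutation (lookup xs) (index ∘ complete)
  (λ x → sym (lookup-index (complete x)))
  (λ i → lookup-injective u (sym (lookup-index (complete (lookup xs i)))))

enumeration⇒permutation : ∀ {n} (xs : List (Fin n)) → Unique xs → (∀ x → x ∈ xs) →
  Σ (Permutation′ n) λ σ → ∀ i → map (σ ⟨$⟩ʳ_) (take i (allFin n)) ≡ take i xs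
enumeration⇒permutation {n} xs u complete = cast-id (sym e) ∘ₚ π , take-lookup-cast xs e
  where
  π : Permutation (length xs) n
  π = enumeration↔ xs u complete
  e : length xs ≡ n
  e = ↔⇒≡ π

∣p∪q∣≤∣p∣+∣q∣ : ∀ {n} (p q : Subset n) → ∣ p ∪ q ∣ ≤ ∣ p ∣ + ∣ q ∣
∣p∪q∣≤∣p∣+∣q∣ []            []            = z≤n
∣p∪q∣≤∣p∣+∣q∣ (inside  ∷ p) (inside  ∷ q) = s≤s (≤-trans (∣p∪q∣≤∣p∣+∣q∣ p q) (+-monoʳ-≤ ∣ p ∣ (n≤1+n _)))
∣p∪q∣≤∣p∣+∣q∣ (inside  ∷ p) (outside ∷ q) = s≤s (∣p∪q∣≤∣p∣+∣q∣ p q)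
∣p∪q∣≤∣p∣+∣q∣ (outside ∷ p) (inside  ∷ q) =
  ≤-trans (s≤s (∣p∪q∣≤∣p∣+∣q∣ p q)) (≤-reflexive (sym (+-suc ∣ p ∣ ∣ q ∣)))
∣p∪q∣≤∣p∣+∣q∣ (outside ∷ p) (outside ∷ q) = ∣p∪q∣≤∣p∣+∣q∣ p q

∈ₛ⇒1≤∣p∣ : ∀ {n} {x : Fin n} {p} → x ∈ₛ p → 1 ≤ ∣ p ∣
∈ₛ⇒1≤∣p∣ {x = x} {p} x∈p =
  subst (_≤ ∣ p ∣) (∣⁅x⁆∣≡1 x) (p⊆q⇒∣p∣≤∣q∣ λ y∈⁅x⁆ → subst (_∈ₛ p) (sym (x∈⁅y⁆⇒x≡y x y∈⁅x⁆)) x∈p)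

module _ {n} (f : A → Subset n) where

  x∈⋃map⁺ : ∀ {x y ys} → y ∈ ys → x ∈ₛ f y → x ∈ₛ ⋃ (map f ys)
  x∈⋃map⁺ (here refl)  x∈fy = x∈p∪q⁺ (inj₁ x∈fy)
  x∈⋃map⁺ (there y∈ys) x∈fy = x∈p∪q⁺ (inj₂ (x∈⋃map⁺ y∈ys x∈fy))

  x∈⋃map⁻ : ∀ {x} ys → x ∈ₛ ⋃ (map f ys) → ∃ λ y → y ∈ ys × x ∈ₛ f y
  x∈⋃map⁻ []       x∈⋃ = ⊥-elim (∉⊥ x∈⋃)
  x∈⋃map⁻ (y ∷ ys) x∈⋃ with x∈p∪q⁻ (f y) (⋃ (map f ys)) x∈⋃
  ... | inj₁ x∈fy = y , here refl , x∈fy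
  ... | inj₂ x∈⋃′ with x∈⋃map⁻ ys x∈⋃′
  ...   | y′ , y′∈ys , x∈fy′ = y′ , there y′∈ys , x∈fy′

∣⋃⁅xs⁆∣≤length : ∀ {n} (xs : List (Fin n)) → ∣ ⋃ (map ⁅_⁆ xs) ∣ ≤ length xs
∣⋃⁅xs⁆∣≤length {n} []       = ≤-reflexive (∣⊥∣≡0 n)
∣⋃⁅xs⁆∣≤length     (x ∷ xs) = begin
  ∣ ⁅ x ⁆ ∪ ⋃ (map ⁅_⁆ xs) ∣      ≤⟨ ∣p∪q∣≤∣p∣+∣q∣ ⁅ x ⁆ _ ⟩
  ∣ ⁅ x ⁆ ∣ + ∣ ⋃ (map ⁅_⁆ xs) ∣  ≡⟨ cong (_+ _) (∣⁅x⁆∣≡1 x) ⟩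
  suc ∣ ⋃ (map ⁅_⁆ xs) ∣          ≤⟨ s≤s (∣⋃⁅xs⁆∣≤length xs) ⟩
  suc (length xs)                 ∎
  where open ≤-Reasoning

∣⋃⁅P⁆∪⋃D∣≤ : ∀ {n} (D : Fin n → Subset n) (P Fr : List (Fin n)) →
  (∀ {w u} → w ∈ P → u ∈ₛ D w → u ∈ P ⊎ u ∈ Fr) →
  ∣ ⋃ (map ⁅_⁆ P) ∪ ⋃ (map D P) ∣ ≤ ∣ ⋃ (map ⁅_⁆ P) ∣ + length Fr
∣⋃⁅P⁆∪⋃D∣≤ {n} D P Fr escape = begin
  ∣ ⋃⁅ P ⁆ ∪ ⋃ (map D P) ∣  ≤⟨ p⊆q⇒∣p∣≤∣q∣ ⊆⋃⁅P⁆∪⋃⁅Fr⁆ ⟩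
  ∣ ⋃⁅ P ⁆ ∪ ⋃⁅ Fr ⁆ ∣      ≤⟨ ∣p∪q∣≤∣p∣+∣q∣ ⋃⁅ P ⁆ ⋃⁅ Fr ⁆ ⟩
  ∣ ⋃⁅ P ⁆ ∣ + ∣ ⋃⁅ Fr ⁆ ∣  ≤⟨ +-monoʳ-≤ ∣ ⋃⁅ P ⁆ ∣ (∣⋃⁅xs⁆∣≤length Fr) ⟩
  ∣ ⋃⁅ P ⁆ ∣ + length Fr    ∎
  where
  open ≤-Reasoning
  ⋃⁅_⁆ : List (Fin n) → Subset n
  ⋃⁅ xs ⁆ = ⋃ (map ⁅_⁆ xs)
  ⊆⋃⁅P⁆∪⋃⁅Fr⁆ : ⋃⁅ P ⁆ ∪ ⋃ (map D P) ⊆ₛ ⋃⁅ P ⁆ ∪ ⋃⁅ Fr ⁆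
  ⊆⋃⁅P⁆∪⋃⁅Fr⁆ x∈ with x∈p∪q⁻ ⋃⁅ P ⁆ _ x∈
  ... | inj₁ x∈P = x∈p∪q⁺ (inj₁ x∈P)
  ... | inj₂ x∈⋃D with x∈⋃map⁻ D P x∈⋃D
  ...   | w , w∈P , x∈Dw with escape w∈P x∈Dw
  ...     | inj₁ x∈P  = x∈p∪q⁺ (inj₁ (x∈⋃map⁺ ⁅_⁆ x∈P (x∈⁅x⁆ _)))
  ...     | inj₂ x∈Fr = x∈p∪q⁺ (inj₂ (x∈⋃map⁺ ⁅_⁆ x∈Fr (x∈⁅x⁆ _)))

-- Rooted trees

data Tree (A : Set) : Set where
  node : A → List (Tree A) → Tree A

module _ {A : Set} where

  root : Tree A → A
  root (node v _) = v

  mutual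
    postorder : Tree A → List A
    postorder (node v ts) = postorders ts ∷ʳ v

    postorders : List (Tree A) → List A
    postorders []       = []
    postorders (t ∷ ts) = postorder t ++ postorders ts

  size : Tree A → ℕ
  size t = length (postorder t)

  data Parent : Tree A → A → A → Set where
    child : ∀ {v t ts} → t ∈ ts → Parent (node v ts) v (root t)
    below : ∀ {v t ts u w} → t ∈ ts → Parent t u w → Parent (node v ts) u w

  root∈postorder : ∀ t → root t ∈ postorder t
  root∈postorder (node v ts) = ∈-++⁺ʳ (postorders ts) (here refl)

  postorder⊑postorders : ∀ {t ts} → t ∈ ts → postorder t ⊑ postorders ts
  postorder⊑postorders {ts = t ∷ ts}  (here refl)  = ++⁺ʳ (postorders ts) ⊆-refl
  postorder⊑postorders {ts = t′ ∷ ts} (there t∈ts) = ++⁺ˡ (postorder t′) (postorder⊑postorders t∈ts)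

  ∈-postorders⁺ : ∀ {x t ts} → t ∈ ts → x ∈ postorder t → x ∈ postorders ts
  ∈-postorders⁺ t∈ts = Sublist.lookup (postorder⊑postorders t∈ts)

  ∈-postorders⁻ : ∀ {x} ts → x ∈ postorders ts → ∃ λ t → t ∈ ts × x ∈ postorder t
  ∈-postorders⁻ (t ∷ ts) x∈ with ∈-++⁻ (postorder t) x∈
  ... | inj₁ x∈t  = t , here refl , x∈t
  ... | inj₂ x∈ts with ∈-postorders⁻ ts x∈ts
  ...   | t′ , t′∈ts , x∈t′ = t′ , there t′∈ts , x∈t′

  postorders-unique : ∀ {ts} → All (λ t → Unique (postorder t)) ts →
    AllPairs (λ s t → Disjoint (postorder s) (postorder t)) ts → Unique (postorders ts)
  postorders-unique []         []           = []
  postorders-unique (ut ∷ uts) (t#ts ∷ ts#) = Unique-++⁺ ut (postorders-unique uts ts#) λ (x∈t , x∈ts) →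
    let s , s∈ts , x∈s = ∈-postorders⁻ _ x∈ts in All.lookup t#ts s∈ts (x∈t , x∈s)

  children-precede-parents : ∀ {t u w} → Parent t u w → w ∷ u ∷ [] ⊑ postorder t
  children-precede-parents (child {t = t} t∈ts) = ++⁺ (from∈ (∈-postorders⁺ t∈ts (root∈postorder t))) ⊆-refl
  children-precede-parents (below {v = v} t∈ts p) =
    ++⁺ʳ [ v ] (⊆-trans (children-precede-parents p) (postorder⊑postorders t∈ts))

  child∈postorder : ∀ {t u w} → Parent t u w → w ∈ postorder t
  child∈postorder p = Sublist.lookup (children-precede-parents p) (here refl)

  parent∈postorder : ∀ {t u w} → Parent t u w → u ∈ postorder t
  parent∈postorder p = Sublist.lookup (children-precede-parents p) (there (here refl))

  postorder-prefix-closed : ∀ {t u w} P {Q} → Unique (postorder t) → P ++ Q ≡ postorder t →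
    Parent t u w → u ∈ P → w ∈ P
  postorder-prefix-closed P u e p =
    earlier-∈-prefix P (subst Unique (sym e) u) (subst (_ ⊑_) (sym e) (children-precede-parents p))

  size≤postorders : ∀ {t ts} → t ∈ ts → size t ≤ length (postorders ts)
  size≤postorders t∈ts = length-mono-≤ (postorder⊑postorders t∈ts)

  size-node : ∀ v ts → size (node v ts) ≡ suc (length (postorders ts))
  size-node v ts = trans (length-++ (postorders ts)) (+-comm _ 1)

  1≤size : ∀ t → 1 ≤ size t
  1≤size (node v ts) = ≤-trans (s≤s z≤n) (≤-reflexive (sym (size-node v ts)))

  size≤size-node : ∀ v {t} ts → t ∈ ts → size t ≤ size (node v ts)
  size≤size-node v {t} ts t∈ts = begin
    size t                        ≤⟨ size≤postorders t∈ts ⟩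
    length (postorders ts)        ≤⟨ n≤1+n _ ⟩
    suc (length (postorders ts))  ≡⟨ size-node v ts ⟨
    size (node v ts)              ∎
    where open ≤-Reasoning

  double≤size-node : ∀ v t ts {m} → m ≤ size t → m ≤ suc (length (postorders ts)) →
    2 * m ≤ size (node v (t ∷ ts))
  double≤size-node v t ts {m} m≤t m≤ts = begin
    m + (m + 0)                            ≤⟨ +-mono-≤ m≤t (≤-trans (≤-reflexive (+-identityʳ m)) m≤ts) ⟩
    size t + suc (length (postorders ts))  ≡⟨ +-suc _ _ ⟩
    suc (size t + length (postorders ts))  ≡⟨ cong suc (length-++ (postorder t)) ⟨
    suc (length (postorders (t ∷ ts)))     ≡⟨ size-node v (t ∷ ts) ⟨
    size (node v (t ∷ ts))                 ∎
    where open ≤-Reasoning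

  HeaviestFirst : List (Tree A) → Set
  HeaviestFirst []       = ⊤
  HeaviestFirst (t ∷ ts) = All (λ s → size s ≤ size t) ts

  data HeavyFirst : Tree A → Set where
    node : ∀ {v ts} → HeaviestFirst ts → All HeavyFirst ts → HeavyFirst (node v ts)

  private
    heavierFirst : DecTotalOrder 0ℓ 0ℓ 0ℓ
    heavierFirst = On.decTotalOrder (Flip.decTotalOrder ≤-decTotalOrder) size

  sortBySize : List (Tree A) → List (Tree A)
  sortBySize = Sort.sort heavierFirst

  sortBySize-↭ : ∀ ts → sortBySize ts ↭ ts
  sortBySize-↭ = Sort.sort-↭ heavierFirst

  sortBySize-heaviestFirst : ∀ ts → HeaviestFirst (sortBySize ts)
  sortBySize-heaviestFirst ts with sortBySize ts | Sort.sort-↗ heavierFirst ts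
  ... | []    | _      = tt
  ... | _ ∷ _ | sorted with Linked⇒AllPairs (λ s≥t t≥r → ≤-trans t≥r s≥t) sorted
  ...   | lighter ∷ _ = lighter

  sortBySize-AllPairs : ∀ {R : Tree A → Tree A → Set} {ts} → (∀ {s t} → R s t → R t s) →
    AllPairs R ts → AllPairs R (sortBySize ts)
  sortBySize-AllPairs {R} {ts} sym-R =
    Permutationₛ.AllPairs-resp-↭ (setoid _) sym-R (resp₂ R) (↭⇒↭ₛ (↭-sym (sortBySize-↭ ts)))

  -- Frontiers of postorder prefixes

  Frontier : Tree A → List A → List A → Set
  Frontier t P Fr = ∀ {u w} → Parent t u w → w ∈ P → u ∈ P ⊎ u ∈ Fr

  Frontiers : List (Tree A) → List A → List A → Set
  Frontiers ts P Fr = ∀ {t} → t ∈ ts → Frontier t P Fr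

  private
    prefix⊆ : ∀ {P B X : List A} {x} → P ++ B ≡ X → x ∈ P → x ∈ X
    prefix⊆ refl = ∈-++⁺ˡ

  frontiers-inside : ∀ {t ts P B Fr} → P ++ B ≡ postorder t → Disjoint (postorder t) (postorders ts) →
    Frontier t P Fr → Frontiers (t ∷ ts) P Fr
  frontiers-inside e t#ts fr (here refl)  = fr
  frontiers-inside e t#ts fr (there s∈ts) p w∈P =
    ⊥-elim (t#ts (prefix⊆ e w∈P , ∈-postorders⁺ s∈ts (child∈postorder p)))

  frontiers-past : ∀ {t ts P Fr} → Disjoint (postorder t) (postorders ts) →
    Frontiers ts P Fr → Frontiers (t ∷ ts) (postorder t ++ P) Fr
  frontiers-past t#ts frs (here refl) p _ = inj₁ (∈-++⁺ˡ (parent∈postorder p))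
  frontiers-past {t} t#ts frs (there s∈ts) p w∈tP with ∈-++⁻ (postorder t) w∈tP
  ... | inj₁ w∈t = ⊥-elim (t#ts (w∈t , ∈-postorders⁺ s∈ts (child∈postorder p)))
  ... | inj₂ w∈P = Sum.map₁ (∈-++⁺ʳ (postorder t)) (frs s∈ts p w∈P)

  frontier-node-inside : ∀ {v t ts P B Fr} → B ≢ [] → Unique (postorder t) →
    Disjoint (postorder t) (postorders ts) → P ++ B ≡ postorder t → Frontier t P Fr →
    Frontier (node v (t ∷ ts)) P Fr
  frontier-node-inside {t = node r cs} {P = P} B≢[] ut t#ts e fr (child (here refl)) r∈P =
    ⊥-elim (last∉proper-prefix P (postorders cs) ut e B≢[] r∈P)
  frontier-node-inside B≢[] ut t#ts e fr (child {t = s} (there s∈ts)) r∈P =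
    ⊥-elim (t#ts (prefix⊆ e r∈P , ∈-postorders⁺ s∈ts (root∈postorder s)))
  frontier-node-inside B≢[] ut t#ts e fr (below s∈ p) = frontiers-inside e t#ts fr s∈ p

  frontier-node-past : ∀ {v t ts P Fr} → Disjoint (postorder t) (postorders ts) →
    Frontiers ts P Fr → Frontier (node v (t ∷ ts)) (postorder t ++ P) (v ∷ Fr)
  frontier-node-past t#ts frs (child _)    _  = inj₂ (here refl)
  frontier-node-past t#ts frs (below s∈ p) w∈ = Sum.map₂ there (frontiers-past t#ts frs s∈ p w∈)

  frontier-bound : ∀ v t ts Fr → HeaviestFirst (t ∷ ts) →
    (Fr ≡ [] ⊎ ∃ λ s → s ∈ ts × 2 ^ length Fr ≤ size s) → 2 ^ length (v ∷ Fr) ≤ size (node v (t ∷ ts))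
  frontier-bound v t ts .[] _ (inj₁ refl) = double≤size-node v t ts (1≤size t) (s≤s z≤n)
  frontier-bound v t ts Fr heaviest (inj₂ (s , s∈ts , 2^Fr≤s)) = double≤size-node v t ts
    (≤-trans 2^Fr≤s (All.lookup heaviest s∈ts))
    (≤-trans 2^Fr≤s (≤-trans (size≤postorders s∈ts) (n≤1+n _)))

  mutual
    frontier : ∀ t P {Q} → HeavyFirst t → Unique (postorder t) → P ++ Q ≡ postorder t →
      Σ (List A) λ Fr → 2 ^ length Fr ≤ size t × Frontier t P Fr
    frontier (node v []) P _ _ _ = [] , ≤-refl , λ { (child ()) ; (below () _) }
    frontier (node v (t ∷ ts)) P (node heaviest (ht ∷ hts)) u e
      with Unique-++⁻ (postorder t) (proj₁ (Unique-++⁻ (postorders (t ∷ ts)) u))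
         | prefix-of-++ P (postorder t) (trans e (++-assoc (postorder t) (postorders ts) [ v ]))
    ... | ut , uts , t#ts | inj₁ (B , B≢[] , e′) =
      let Fr , 2^Fr≤t , fr = frontier t P ht ut e′
      in  Fr , ≤-trans 2^Fr≤t (size≤size-node v (t ∷ ts) (here refl)) ,
          frontier-node-inside B≢[] ut t#ts e′ fr
    ... | ut , uts , t#ts | inj₂ (P′ , refl , e′) =
      let Fr , light , frs = frontiers ts P′ hts uts e′
      in  v ∷ Fr , frontier-bound v t ts Fr heaviest light , frontier-node-past t#ts frs

    -- R is what follows the forest ts in an enclosing postorder; P may reach into it.
    frontiers : ∀ ts P {Q R} → All HeavyFirst ts → Unique (postorders ts) → P ++ Q ≡ postorders ts ++ R →
      Σ (List A) λ Fr → (Fr ≡ [] ⊎ ∃ λ t → t ∈ ts × 2 ^ length Fr ≤ size t) × Frontiers ts P Fr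
    frontiers [] P _ _ _ = [] , inj₁ refl , λ ()
    frontiers (t ∷ ts) P {R = R} (ht ∷ hts) u e
      with Unique-++⁻ (postorder t) u
         | prefix-of-++ P (postorder t) (trans e (++-assoc (postorder t) (postorders ts) R))
    ... | ut , uts , t#ts | inj₁ (B , _ , e′) =
      let Fr , 2^Fr≤t , fr = frontier t P ht ut e′
      in  Fr , inj₂ (t , here refl , 2^Fr≤t) , frontiers-inside e′ t#ts fr
    ... | ut , uts , t#ts | inj₂ (P′ , refl , e′) =
      let Fr , light , frs = frontiers ts P′ hts uts e′
      in  Fr , Sum.map₂ (λ (s , s∈ts , 2^Fr≤s) → s , there s∈ts , 2^Fr≤s) light , frontiers-past t#ts frs

-- Non-backtracking walks in the skeleton

module Walks {n} (D : Digraph n) where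

  Adj-sym : ∀ {x y} → Adj D x y → Adj D y x
  Adj-sym = Sum.swap

  NoReturn : Fin n → List (Fin n) → Set
  NoReturn x (_ ∷ z ∷ _) = x ≢ z
  NoReturn x _           = ⊤

  data NonBacktracking : List (Fin n) → Set where
    []   : NonBacktracking []
    [-]  : ∀ {x} → NonBacktracking [ x ]
    step : ∀ {x y ys} → Adj D x y → NoReturn x (y ∷ ys) → NonBacktracking (y ∷ ys) →
           NonBacktracking (x ∷ y ∷ ys)

  NonBacktracking⇒Linked : ∀ {xs} → NonBacktracking xs → Linked (Adj D) xs
  NonBacktracking⇒Linked []             = []
  NonBacktracking⇒Linked [-]            = [-]
  NonBacktracking⇒Linked (step xy _ nb) = xy ∷ NonBacktracking⇒Linked nb

  NonBacktracking-++⁻ˡ : ∀ xs {ys} → NonBacktracking (xs ++ ys) → NonBacktracking xs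
  NonBacktracking-++⁻ˡ []               _                = []
  NonBacktracking-++⁻ˡ (x ∷ [])         _                = [-]
  NonBacktracking-++⁻ˡ (x ∷ y ∷ [])     (step xy _ _)    = step xy tt [-]
  NonBacktracking-++⁻ˡ (x ∷ y ∷ z ∷ xs) (step xy x≢z nb) = step xy x≢z (NonBacktracking-++⁻ˡ (y ∷ z ∷ xs) nb)

  NonBacktracking-glue : ∀ xs {a b c ys} → NonBacktracking (xs ++ a ∷ b ∷ []) →
    NonBacktracking (b ∷ c ∷ ys) → a ≢ c → NonBacktracking (xs ++ a ∷ b ∷ c ∷ ys)
  NonBacktracking-glue []               (step ab _ _)   bc a≢c = step ab a≢c bc
  NonBacktracking-glue (x ∷ [])         (step xy nr nb) bc a≢c =
    step xy nr (NonBacktracking-glue [] nb bc a≢c)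
  NonBacktracking-glue (x ∷ y ∷ [])     (step xy nr nb) bc a≢c =
    step xy nr (NonBacktracking-glue (y ∷ []) nb bc a≢c)
  NonBacktracking-glue (x ∷ y ∷ z ∷ xs) (step xy nr nb) bc a≢c =
    step xy nr (NonBacktracking-glue (y ∷ z ∷ xs) nb bc a≢c)

  NonBacktracking-reverse : ∀ {xs} → NonBacktracking xs → NonBacktracking (reverse xs)
  NonBacktracking-reverse []              = []
  NonBacktracking-reverse [-]             = [-]
  NonBacktracking-reverse (step xy _ [-]) = step (Adj-sym xy) tt [-]
  NonBacktracking-reverse (step {x} {y} {z ∷ ys} xy x≢z nb) =
    subst NonBacktracking (sym (reverse-++ (x ∷ y ∷ z ∷ []) ys))
      (NonBacktracking-glue (reverse ys)
        (subst NonBacktracking (reverse-++ (y ∷ z ∷ []) ys) (NonBacktracking-reverse nb))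
        (step (Adj-sym xy) tt [-])
        (x≢z ∘ sym))

  module Forest (loopless : ∀ {x} → ¬ Adj D x x) (forest : SkeletonForest D) where

    head∉ : ∀ {x xs} → NonBacktracking (x ∷ xs) → Unique xs → x ∉ xs
    head∉ {x} nb u x∈xs with ∈-∃++ x∈xs
    ... | ys , zs , refl = forest (x , ys , cycle-unique , 2≤length ys nb , cycle-linked)
      where
      cycle-unique : Unique (x ∷ ys)
      cycle-unique = let uys , _ , ys#xzs = Unique-++⁻ ys u
                     in  ¬Any⇒All¬ ys (λ x∈ys → ys#xzs (x∈ys , here refl)) ∷ uys
      2≤length : ∀ ys → NonBacktracking (x ∷ ys ++ x ∷ zs) → 2 ≤ length ys
      2≤length []          (step xx _ _)  = ⊥-elim (loopless xx)
      2≤length (_ ∷ [])    (step _ x≢x _) = ⊥-elim (x≢x refl)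
      2≤length (_ ∷ _ ∷ _) _              = s≤s (s≤s z≤n)
      cycle-linked : Linked (Adj D) ((x ∷ ys) ++ [ x ])
      cycle-linked = NonBacktracking⇒Linked
        (NonBacktracking-++⁻ˡ ((x ∷ ys) ∷ʳ x) (subst NonBacktracking (sym (∷ʳ-++ (x ∷ ys) x zs)) nb))

    NonBacktracking⇒Unique : ∀ {xs} → NonBacktracking xs → Unique xs
    NonBacktracking⇒Unique []                = []
    NonBacktracking⇒Unique [-]               = [] ∷ []
    NonBacktracking⇒Unique nb@(step _ _ nb′) =
      let u = NonBacktracking⇒Unique nb′ in ¬Any⇒All¬ _ (head∉ nb u) ∷ u

    branches-disjoint : ∀ xs ys {a b v zs zs′} →
      NonBacktracking (xs ++ a ∷ v ∷ zs) → NonBacktracking (ys ++ b ∷ v ∷ zs′) → a ≢ b →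
      Disjoint (xs ∷ʳ a) (ys ∷ʳ b)
    branches-disjoint xs ys {a} {b} {v} nb₁ nb₂ a≢b {x} (x∈xsa , x∈ysb) =
      Unique-++⇒Disjoint (xs ∷ʳ a) glued-unique (x∈xsa , there x∈b∷ys)
      where
      up-to-v : ∀ ws {c zs} → NonBacktracking (ws ++ c ∷ v ∷ zs) → NonBacktracking (ws ++ c ∷ v ∷ [])
      up-to-v ws {c} {zs} nb =
        NonBacktracking-++⁻ˡ (ws ++ c ∷ v ∷ []) (subst NonBacktracking (sym (++-assoc ws (c ∷ v ∷ []) zs)) nb)
      from-v : NonBacktracking (v ∷ b ∷ reverse ys)
      from-v = subst NonBacktracking (reverse-++ ys (b ∷ v ∷ [])) (NonBacktracking-reverse (up-to-v ys nb₂))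
      glued-unique : Unique ((xs ∷ʳ a) ++ v ∷ b ∷ reverse ys)
      glued-unique = subst Unique (sym (∷ʳ-++ xs a _))
        (NonBacktracking⇒Unique (NonBacktracking-glue xs (up-to-v xs nb₁) from-v a≢b))
      x∈b∷ys : x ∈ b ∷ reverse ys
      x∈b∷ys = subst (x ∈_) (reverse-++ ys [ b ]) (reverse⁺ x∈ysb)

-- A heavy-first spanning tree

record HeavyFirstSpanningTree {n} (D : Digraph n) : Set where
  field
    tree       : Tree (Fin n)
    unique     : Unique (postorder tree)
    complete   : ∀ x → x ∈ postorder tree
    heavyFirst : HeavyFirst tree
    adjacent   : ∀ {x y} → Adj D x y → Parent tree x y ⊎ Parent tree y x

module Unfolding {n} (D : Digraph n) (loopless : ∀ {x} → ¬ Adj D x x) (forest : SkeletonForest D) where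
  open Walks D
  open Forest loopless forest

  Continues : Fin n → List (Fin n) → Fin n → Set
  Continues v back w = Adj D w v × NoReturn w (v ∷ back)

  continues? : ∀ v back w → Dec (Continues v back w)
  continues? v back w = (w ∈? D v ⊎-dec v ∈? D w) ×-dec noReturn? back
    where
    noReturn? : ∀ back → Dec (NoReturn w (v ∷ back))
    noReturn? []      = yes tt
    noReturn? (b ∷ _) = ¬? (w ≟ b)

  successors : Fin n → List (Fin n) → List (Fin n)
  successors v back = filter (continues? v back) (allFin n)

  -- The subtree at v, where v ∷ back is the non-backtracking walk from v up to the root;
  -- the depth bound f is never reached when f = n, as such walks repeat no vertex.
  mutual
    unfold : ℕ → Fin n → List (Fin n) → Tree (Fin n)
    unfold f v back = node v (branches f v back)

    branches : ℕ → Fin n → List (Fin n) → List (Tree (Fin n))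
    branches zero    v back = []
    branches (suc f) v back = sortBySize (map (λ w → unfold f w (v ∷ back)) (successors v back))

  ∈-branches⁻ : ∀ {f v back t} → t ∈ branches (suc f) v back →
    ∃ λ w → t ≡ unfold f w (v ∷ back) × Continues v back w
  ∈-branches⁻ {f} {v} {back} t∈ with ∈-map⁻ (λ w → unfold f w (v ∷ back)) (∈-resp-↭ (sortBySize-↭ _) t∈)
  ... | w , w∈ , refl = w , refl , proj₂ (∈-filter⁻ (continues? v back) {xs = allFin n} w∈)

  ∈-branches⁺ : ∀ {f v back w} → Continues v back w → unfold f w (v ∷ back) ∈ branches (suc f) v back
  ∈-branches⁺ {v = v} {back} {w} c =
    ∈-resp-↭ (↭-sym (sortBySize-↭ _)) (∈-map⁺ _ (∈-filter⁺ (continues? v back) (∈-allFin w) c))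

  ∈-postorders-branches⁻ : ∀ {f v back x} → x ∈ postorders (branches (suc f) v back) →
    ∃ λ w → Continues v back w × x ∈ postorder (unfold f w (v ∷ back))
  ∈-postorders-branches⁻ {f} {v} {back} x∈ with ∈-postorders⁻ (branches (suc f) v back) x∈
  ... | t , t∈bs , x∈t with ∈-branches⁻ {f} {v} {back} t∈bs
  ...   | w , refl , c = w , c , x∈t

  private
    extend : ∀ {v back w} → NonBacktracking (v ∷ back) → Continues v back w → NonBacktracking (w ∷ v ∷ back)
    extend nb (wv , nr) = step wv nr nb

  unfold-walk : ∀ f {v back x} → NonBacktracking (v ∷ back) → x ∈ postorder (unfold f v back) →
    ∃ λ ws → NonBacktracking (ws ++ v ∷ back) × x ∈ ws ∷ʳ v
  unfold-walk zero    nb (here refl) = [] , nb , here refl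
  unfold-walk (suc f) {v} {back} nb x∈ with ∈-++⁻ (postorders (branches (suc f) v back)) x∈
  ... | inj₂ (here refl) = [] , nb , here refl
  ... | inj₁ x∈bs with ∈-postorders-branches⁻ {f} x∈bs
  ...   | w , c , x∈w with unfold-walk f (extend nb c) x∈w
  ...     | ws , nb′ , x∈ws = ws ∷ʳ w , subst NonBacktracking (sym (∷ʳ-++ ws w _)) nb′ , ∈-++⁺ˡ x∈ws

  unfold-unique : ∀ f {v back} → NonBacktracking (v ∷ back) → Unique (postorder (unfold f v back))
  unfold-unique zero    _ = [] ∷ []
  unfold-unique (suc f) {v} {back} nb =
    Unique-++⁺ (postorders-unique branches-unique branches-pairwise-disjoint) ([] ∷ []) v∉branches
    where
    branches-unique : All (λ t → Unique (postorder t)) (branches (suc f) v back)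
    branches-unique = All.tabulate λ t∈ → let w , t≡ , c = ∈-branches⁻ {f} {v} {back} t∈ in
      subst (Unique ∘ postorder) (sym t≡) (unfold-unique f (extend nb c))

    successor-branches-disjoint : ∀ {w w′} → Continues v back w → Continues v back w′ → w ≢ w′ →
      Disjoint (postorder (unfold f w (v ∷ back))) (postorder (unfold f w′ (v ∷ back)))
    successor-branches-disjoint c c′ w≢w′ (x∈ , x∈′) =
      let ws  , nbw  , x∈ws  = unfold-walk f (extend nb c) x∈
          ws′ , nbw′ , x∈ws′ = unfold-walk f (extend nb c′) x∈′
      in  branches-disjoint ws ws′ nbw nbw′ w≢w′ (x∈ws , x∈ws′)

    branches-pairwise-disjoint :
      AllPairs (λ s t → Disjoint (postorder s) (postorder t)) (branches (suc f) v back)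
    branches-pairwise-disjoint = sortBySize-AllPairs (λ s#t (x∈t , x∈s) → s#t (x∈s , x∈t))
      (AllPairs.map⁺ (AllPairs-of-distinct successor-branches-disjoint
        (all-filter (continues? v back) (allFin n)) (filter⁺ (continues? v back) (allFin⁺ n))))

    v∉branches : Disjoint (postorders (branches (suc f) v back)) [ v ]
    v∉branches (v∈bs , here refl) with ∈-postorders-branches⁻ {f} v∈bs
    ... | w , c , v∈w with unfold-walk f (extend nb c) v∈w
    ...   | ws , nbw , v∈ws = Unique-++⇒Disjoint (ws ∷ʳ w)
      (subst Unique (sym (∷ʳ-++ ws w _)) (NonBacktracking⇒Unique nbw)) (v∈ws , here refl)

  unfold-heavyFirst : ∀ f v back → HeavyFirst (unfold f v back)
  unfold-heavyFirst zero    v back = node tt []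
  unfold-heavyFirst (suc f) v back = node (sortBySize-heaviestFirst _) (All.tabulate λ t∈ →
    let w , t≡ , _ = ∈-branches⁻ {f} {v} {back} t∈
    in  subst HeavyFirst (sym t≡) (unfold-heavyFirst f w (v ∷ back)))

  returns⊎continues : ∀ v back {x} → Adj D v x → head back ≡ just x ⊎ Continues v back x
  returns⊎continues v []      vx = inj₂ (Adj-sym vx , tt)
  returns⊎continues v (b ∷ _) {x} vx with x ≟ b
  ... | yes refl = inj₁ refl
  ... | no x≢b   = inj₂ (Adj-sym vx , x≢b)

  unfold-adjacent : ∀ f {v back x y} → length back + f ≡ n → NonBacktracking (v ∷ back) →
    y ∈ postorder (unfold f v back) → Adj D y x →
    Parent (unfold f v back) x y ⊎ Parent (unfold f v back) y x ⊎ (y ≡ v × head back ≡ just x)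
  unfold-adjacent zero {back = back} fuel nb _ _ = ⊥-elim (1+n≰n (begin
    suc (length back)  ≤⟨ Unique⇒length≤ (NonBacktracking⇒Unique nb) ⟩
    n                  ≡⟨ fuel ⟨
    length back + 0    ≡⟨ +-identityʳ _ ⟩
    length back        ∎))
    where open ≤-Reasoning
  unfold-adjacent (suc f) {v} {back} fuel nb y∈ yx with ∈-++⁻ (postorders (branches (suc f) v back)) y∈
  ... | inj₂ (here refl) with returns⊎continues v back yx
  ...   | inj₁ returns   = inj₂ (inj₂ (refl , returns))
  ...   | inj₂ continues = inj₂ (inj₁ (child (∈-branches⁺ {f} continues)))
  unfold-adjacent (suc f) {v} {back} fuel nb y∈ yx | inj₁ y∈bs with ∈-postorders-branches⁻ {f} y∈bs
  ... | w , c , y∈w with unfold-adjacent f (trans (sym (+-suc _ f)) fuel) (extend nb c) y∈w yx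
  ...   | inj₁ p                    = inj₁ (below (∈-branches⁺ {f} c) p)
  ...   | inj₂ (inj₁ p)             = inj₂ (inj₁ (below (∈-branches⁺ {f} c) p))
  ...   | inj₂ (inj₂ (refl , refl)) = inj₁ (child (∈-branches⁺ {f} c))

  spanningTree : SkeletonConnected D → Fin n → HeavyFirstSpanningTree D
  spanningTree connected r = record
    { tree       = t
    ; unique     = unfold-unique n [-]
    ; complete   = λ x → reach (root∈postorder t) (connected r x)
    ; heavyFirst = unfold-heavyFirst n r []
    ; adjacent   = λ {x} xy → Sum.swap (adjacent′ (reach (root∈postorder t) (connected r x)) xy)
    }
    where
    t : Tree (Fin n)
    t = unfold n r []
    adjacent′ : ∀ {x y} → y ∈ postorder t → Adj D y x → Parent t x y ⊎ Parent t y x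
    adjacent′ y∈ yx with unfold-adjacent n refl [-] y∈ yx
    ... | inj₁ p        = inj₁ p
    ... | inj₂ (inj₁ p) = inj₂ p
    reach : ∀ {x y} → x ∈ postorder t → Star (Adj D) x y → y ∈ postorder t
    reach x∈ ε        = x∈
    reach x∈ (xy ◅ s) = reach ([ parent∈postorder , child∈postorder ]′ (adjacent′ x∈ xy)) s

IsDAG⇒loopless : ∀ {n} (D : Digraph n) → IsDAG D → ∀ {x} → ¬ Adj D x x
IsDAG⇒loopless D dag {x} = dag x ∘ [ edge , edge ]′

module _ {n} {D : Digraph n} (H : HeavyFirstSpanningTree D) where
  open HeavyFirstSpanningTree H

  parents-outside-prefix : ∀ P {Q} → P ++ Q ≡ postorder tree →
    ∃ λ Fr → length Fr ≤ ⌈log₂ n ⌉ × (∀ {w u} → w ∈ P → u ∈ₛ D w → u ∈ P ⊎ u ∈ Fr)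
  parents-outside-prefix P e with frontier tree P heavyFirst unique e
  ... | Fr , 2^Fr≤size , fr = Fr , Fr≤log , escape
    where
    Fr≤log : length Fr ≤ ⌈log₂ n ⌉
    Fr≤log = subst (_≤ ⌈log₂ n ⌉) (⌈log₂2^n⌉≡n (length Fr))
      (⌈log₂⌉-mono-≤ (≤-trans 2^Fr≤size (Unique⇒length≤ unique)))
    escape : ∀ {w u} → w ∈ P → u ∈ₛ D w → u ∈ P ⊎ u ∈ Fr
    escape w∈P u∈Dw with adjacent (inj₁ u∈Dw)
    ... | inj₁ u-parent = fr u-parent w∈P
    ... | inj₂ u-child  = inj₁ (postorder-prefix-closed P unique e u-child w∈P)

  postorder-ordering : Σ (Permutation′ n) λ σ → ∀ i → ∣ S D σ i ∣ ≤ ∣ T D σ i ∣ + ⌈log₂ n ⌉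
  postorder-ordering with enumeration⇒permutation (postorder tree) unique complete
  ... | σ , firsts≡take = σ , bound
    where
    bound : ∀ i → ∣ S D σ i ∣ ≤ ∣ T D σ i ∣ + ⌈log₂ n ⌉
    bound i with parents-outside-prefix (take i (postorder tree)) (take++drop≡id i _)
    ... | Fr , Fr≤log , escape =
      subst (λ F → ∣ ⋃ (map ⁅_⁆ F) ∪ ⋃ (map D F) ∣ ≤ ∣ ⋃ (map ⁅_⁆ F) ∣ + ⌈log₂ n ⌉) (sym (firsts≡take i))
        (≤-trans (∣⋃⁅P⁆∪⋃D∣≤ D _ Fr escape) (+-monoʳ-≤ _ Fr≤log))

polytree-ordering : ∀ {n} (D : Digraph n) → IsConnectedPolytree D → Fin n →
  Σ (Permutation′ n) λ σ → ∀ i → ∣ S D σ i ∣ ≤ ∣ T D σ i ∣ + ⌈log₂ n ⌉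
polytree-ordering D (dag , connected , forest) r =
  postorder-ordering (Unfolding.spanningTree D (IsDAG⇒loopless D dag) forest connected r)

connected⇒1≤indegree : ∀ {n k} (D : Digraph n) → SkeletonConnected D → MaxInDegree≤ D k → 2 ≤ n → 1 ≤ k
connected⇒1≤indegree D connected indegree (s≤s (s≤s _)) with connected Fin.zero (Fin.suc Fin.zero)
... | inj₁ 0∈Dy ◅ _ = ≤-trans (∈ₛ⇒1≤∣p∣ 0∈Dy) (indegree _)
... | inj₂ y∈D0 ◅ _ = ≤-trans (∈ₛ⇒1≤∣p∣ y∈D0) (indegree _)

lemma3p2 : Σ ℕ λ c → (0 < c) × ((n k : ℕ) → 2 ≤ n → (D : Digraph n) →
    IsConnectedPolytree D → MaxInDegree≤ D k →
    Σ (Permutation′ n) λ σ → (i : ℕ) → 1 ≤ i → i ≤ n →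
      ∣ S D σ i ∣ ≤ ∣ T D σ i ∣ + c * k * ⌈log₂ n ⌉)
lemma3p2 = 1 , s≤s z≤n , ordering
  where
  ordering : (n k : ℕ) → 2 ≤ n → (D : Digraph n) → IsConnectedPolytree D → MaxInDegree≤ D k →
    Σ (Permutation′ n) λ σ → (i : ℕ) → 1 ≤ i → i ≤ n → ∣ S D σ i ∣ ≤ ∣ T D σ i ∣ + 1 * k * ⌈log₂ n ⌉
  ordering n k 2≤n@(s≤s _) D polytree@(_ , connected , _) indegree with polytree-ordering D polytree Fin.zero
  ... | σ , bound = σ , λ i _ _ → ≤-trans (bound i) (+-monoʳ-≤ _ log≤k*log)
    where
    log≤k*log : ⌈log₂ n ⌉ ≤ 1 * k * ⌈log₂ n ⌉
    log≤k*log = begin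
      ⌈log₂ n ⌉          ≡⟨ *-identityˡ _ ⟨
      1 * ⌈log₂ n ⌉      ≤⟨ *-monoˡ-≤ ⌈log₂ n ⌉ 1≤1*k ⟩
      1 * k * ⌈log₂ n ⌉  ∎
      where
      open ≤-Reasoning
      1≤1*k : 1 ≤ 1 * k
      1≤1*k = ≤-trans (connected⇒1≤indegree D connected indegree 2≤n) (≤-reflexive (sym (*-identityˡ k)))
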